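{- Let $r\ge 1$, $a \ge 0$, $d \ge 1$, $s\ge 0$ be integers and $x$ a positive integer. Suppose that all simple $(d,d+s)$-graphs have an $(r,r+a)$-factorization with $x$ factors. Then $\frac{d+s}{r+a} \le x \le \frac{d}{r}$.
   Context: All graphs are finite simple graphs. A $(d,d+s)$-graph is a graph all of whose vertex degrees lie in $\{d, \ldots, d+s\}$. An $(r,r+a)$-factor of $G$ is a spanning subgraph all of whose degrees lie in $\{r,\ldots,r+a\}$; an $(r,r+a)$-factorization of $G$ with $x$ factors is a decomposition of $E(G)$ into $x$ edge-disjoint $(r,r+a)$-factors. -}

module Defs where

open import Data.Nat using (ℕ; zero; suc; _+_; _*_; _≤_)
open import Data.Bool using (Bool; true; false; _∧_; if_then_else_)
open import Data.Fin using (Fin) renaming (zero to fzero; suc to fsuc)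
import Data.Fin as F
open import Data.Product using (_×_)
open import Relation.Binary.PropositionalEquality using (_≡_)
open import Relation.Nullary.Decidable using (⌊_⌋)

count : ∀ {n} → (Fin n → Bool) → ℕ
count {zero}  p = 0
count {suc n} p = (if p fzero then 1 else 0) + count (λ i → p (fsuc i))

record Graph : Set where
  field
    n     : ℕ
    adj   : Fin n → Fin n → Bool
    sym   : ∀ u v → adj u v ≡ adj v u
    loopless : ∀ u → adj u u ≡ false
open Graph public

degree : (G : Graph) → Fin (n G) → ℕ
degree G u = count (adj G u)

IsDegRange : ℕ → ℕ → Graph → Set
IsDegRange d s G = ∀ u → d ≤ degree G u × degree G u ≤ d + s

-- An edge colouring with x colours; colour class i is the i-th factor.
-- Symmetry ensures each edge {u,v} gets a single colour, so the colour
-- classes are edge-disjoint and cover E(G).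
record Colouring (G : Graph) (x : ℕ) : Set where
  field
    col    : Fin (n G) → Fin (n G) → Fin x
    colSym : ∀ u v → col u v ≡ col v u
open Colouring public

factorDegree : (G : Graph) {x : ℕ} → Colouring G x → Fin x → Fin (n G) → ℕ
factorDegree G c i u = count (λ v → adj G u v ∧ ⌊ col c u v F.≟ i ⌋)

IsFactorization : (r a x : ℕ) (G : Graph) → Colouring G x → Set
IsFactorization r a x G c =
  ∀ (i : Fin x) (u : Fin (n G)) →
    r ≤ factorDegree G c i u × factorDegree G c i u ≤ r + a

HasFactorization : (r a x : ℕ) → Graph → Set
HasFactorization r a x G = Data.Product.Σ (Colouring G x) (IsFactorization r a x G)

-- Every vertex degree of G is the sum of its x factor degrees, so it lies between x r and
-- x (r + a).  The complete graphs K_{d+1} and K_{d+s+1} are (d, d+s)-graphs, regular of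
-- degree d and d + s respectively, which gives x r ≤ d and d + s ≤ x (r + a).
module Submission where

open import Defs
open import Data.Nat using (ℕ; zero; suc; _+_; _*_; _≤_)
open import Data.Nat.Properties using (+-0-commutativeMonoid; ≤-refl; m≤m+n; +-mono-≤; module ≤-Reasoning)
open import Data.Bool using (Bool; true; false; _∧_; not; if_then_else_)
open import Data.Fin using (Fin; _≟_) renaming (zero to fzero; suc to fsuc)
open import Data.Product using (_×_; _,_; proj₁; proj₂)
open import Function using (mk⇔)
open import Relation.Binary.PropositionalEquality as ≡
  using (_≡_; refl; trans; cong; cong₂; subst; module ≡-Reasoning)
open import Relation.Nullary.Decidable using (⌊_⌋; does; isYes≗does; dec-true; does-⇔)
open import Algebra.Properties.CommutativeMonoid.Sum +-0-commutativeMonoid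
  using (sum; sum-cong-≗; sum-replicate-zero; ∑-distrib-+)

indicator : Bool → ℕ
indicator b = if b then 1 else 0

sum-const : ∀ k c → sum {k} (λ _ → c) ≡ k * c
sum-const zero    c = refl
sum-const (suc k) c = cong (c +_) (sum-const k c)

sum-mono-≤ : ∀ {k} {f g : Fin k → ℕ} → (∀ i → f i ≤ g i) → sum f ≤ sum g
sum-mono-≤ {zero}  f≤g = ≤-refl
sum-mono-≤ {suc k} f≤g = +-mono-≤ (f≤g fzero) (sum-mono-≤ (λ i → f≤g (fsuc i)))

sum-indicator-≟ : ∀ {x} (k : Fin x) → sum (λ i → indicator ⌊ k ≟ i ⌋) ≡ 1
sum-indicator-≟ {suc x} fzero    = cong suc (sum-replicate-zero x)
sum-indicator-≟ {suc x} (fsuc k) = trans (sum-cong-≗ ⌊suc≟suc⌋) (sum-indicator-≟ k)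
  where
  ⌊suc≟suc⌋ : ∀ i → indicator ⌊ fsuc k ≟ fsuc i ⌋ ≡ indicator ⌊ k ≟ i ⌋
  ⌊suc≟suc⌋ i = cong indicator (trans (isYes≗does (fsuc k ≟ fsuc i)) (≡.sym (isYes≗does (k ≟ i))))

sum-indicator-∧-≟ : ∀ {x} b (k : Fin x) → sum (λ i → indicator (b ∧ ⌊ k ≟ i ⌋)) ≡ indicator b
sum-indicator-∧-≟ {x} false k = sum-replicate-zero x
sum-indicator-∧-≟     true  k = sum-indicator-≟ k

count-partition : ∀ {m x} (p : Fin m → Bool) (f : Fin m → Fin x) →
  count p ≡ sum (λ i → count (λ v → p v ∧ ⌊ f v ≟ i ⌋))
count-partition {zero}  {x} p f = ≡.sym (sum-replicate-zero x)
count-partition {suc m}     p f = begin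
  indicator (p fzero) + count (λ v → p (fsuc v))
    ≡⟨ cong₂ _+_ (≡.sym (sum-indicator-∧-≟ (p fzero) (f fzero)))
                 (count-partition (λ v → p (fsuc v)) (λ v → f (fsuc v))) ⟩
  sum (λ i → indicator (p fzero ∧ ⌊ f fzero ≟ i ⌋)) + sum (λ i → count (λ v → p (fsuc v) ∧ ⌊ f (fsuc v) ≟ i ⌋))
    ≡⟨ ≡.sym (∑-distrib-+ (λ i → indicator (p fzero ∧ ⌊ f fzero ≟ i ⌋)) _) ⟩
  sum (λ i → count (λ v → p v ∧ ⌊ f v ≟ i ⌋)) ∎
  where open ≡-Reasoning

degree≡sum-factorDegree : (G : Graph) {x : ℕ} (c : Colouring G x) (u : Fin (n G)) →
  degree G u ≡ sum (λ i → factorDegree G c i u)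
degree≡sum-factorDegree G c u = count-partition (adj G u) (col c u)

factorization-degree-bounds : ∀ {r a x} (G : Graph) → HasFactorization r a x G →
  ∀ u → x * r ≤ degree G u × degree G u ≤ x * (r + a)
factorization-degree-bounds {r} {a} {x} G (c , fac) u = lower , upper
  where
  open ≤-Reasoning
  lower : x * r ≤ degree G u
  lower = begin
    x * r                                 ≡⟨ ≡.sym (sum-const x r) ⟩
    sum {x} (λ _ → r)                     ≤⟨ sum-mono-≤ (λ i → proj₁ (fac i u)) ⟩
    sum (λ i → factorDegree G c i u)      ≡⟨ ≡.sym (degree≡sum-factorDegree G c u) ⟩
    degree G u                            ∎
  upper : degree G u ≤ x * (r + a)
  upper = begin
    degree G u                            ≡⟨ degree≡sum-factorDegree G c u ⟩
    sum (λ i → factorDegree G c i u)      ≤⟨ sum-mono-≤ (λ i → proj₂ (fac i u)) ⟩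
    sum {x} (λ _ → r + a)                 ≡⟨ sum-const x (r + a) ⟩
    x * (r + a)                           ∎

complete : ℕ → Graph
complete m = record
  { n        = suc m
  ; adj      = λ u v → not (does (u ≟ v))
  ; sym      = λ u v → cong not (does-⇔ (mk⇔ ≡.sym ≡.sym) (u ≟ v) (v ≟ u))
  ; loopless = λ u → cong not (dec-true (u ≟ u) refl)
  }

count-true : ∀ m → count {m} (λ _ → true) ≡ m
count-true zero    = refl
count-true (suc m) = cong suc (count-true m)

degree-complete : ∀ m (u : Fin (suc m)) → degree (complete m) u ≡ m
degree-complete m       fzero    = count-true m
degree-complete (suc m) (fsuc u) = cong suc (degree-complete m u)

lemma13 : (r a d s x : ℕ) → 1 ≤ r → 1 ≤ d → 1 ≤ x →
    ((G : Graph) → IsDegRange d s G → HasFactorization r a x G) →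
    (d + s ≤ x * (r + a)) × (x * r ≤ d)
lemma13 r a d s x _ _ _ factorizable =
  proj₂ (bounds (d + s) (m≤m+n d s) ≤-refl) , proj₁ (bounds d ≤-refl (m≤m+n d s))
  where
  bounds : ∀ m → d ≤ m → m ≤ d + s → x * r ≤ m × m ≤ x * (r + a)
  bounds m d≤m m≤d+s = subst (λ k → x * r ≤ k × k ≤ x * (r + a)) (degree-complete m fzero)
    (factorization-degree-bounds (complete m) (factorizable (complete m) inRange) fzero)
    where
    inRange : IsDegRange d s (complete m)
    inRange u rewrite degree-complete m u = d≤m , m≤d+s
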